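{- Let $d\ge2$, let $A$ be a non-singular $d\times d$ integer matrix and $r$ an integer with $0\le r\le d-2$, and assume that $A$ does not have finite global $r$-order, i.e. there is no $k\ge1$ such that $A^k-I$ has rank at most $r$. For $n\ge1$ and $s\ge1$ let $x_{n,s,i}$, $i=1,\dots,\binom{d}{s}^2$, be the determinants of the $s\times s$ minors of $A^n-I$. Then $$\lim_{N\to\infty}\frac{\mathrm{ord}(A,N,r)}{\log N}=+\infty$$ holds if and only if: for every $\epsilon>0$, $\gcd_i(x_{n,r+1,i})<\exp(\epsilon n)$ for all $n$ sufficiently large (depending on $\epsilon$).
   Context: For a positive integer $N$, the $N$-rank of an integer matrix $M$ is the greatest integer $s\ge0$ such that some $s\times s$ minor of $M$ has determinant not divisible by $N$. $\mathrm{ord}(A,N,r)$ is the smallest positive integer $k$ such that the $N$-rank of $A^k-I$ is at most $r$, and $\mathrm{ord}(A,N,r)=\infty$ if no such $k$ exists. -}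

module Defs where

open import Data.Nat as ℕ using (ℕ; zero; suc)
open import Data.Nat.Divisibility as ℕD using ()
open import Data.Integer as ℤ using (ℤ; +_; -_; ∣_∣)
open import Data.Fin using (Fin; zero; suc; toℕ; punchIn; _<_)
open import Data.Product using (Σ; _×_)
open import Relation.Nullary using (¬_)
open import Relation.Binary.PropositionalEquality using (_≡_)

Mat : ℕ → ℕ → Set
Mat m n = Fin m → Fin n → ℤ

sumFin : ∀ {n} → (Fin n → ℤ) → ℤ
sumFin {zero}  f = + 0
sumFin {suc n} f = f zero ℤ.+ sumFin (λ i → f (suc i))

identity : ∀ {d} → Mat d d
identity i j with i Data.Fin.≟ j
... | Relation.Nullary.yes _ = + 1
... | Relation.Nullary.no  _ = + 0
  where import Data.Fin

_⊗_ : ∀ {d} → Mat d d → Mat d d → Mat d d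
(A ⊗ B) i j = sumFin (λ k → A i k ℤ.* B k j)

_⊖_ : ∀ {d} → Mat d d → Mat d d → Mat d d
(A ⊖ B) i j = A i j ℤ.- B i j

matPow : ∀ {d} → Mat d d → ℕ → Mat d d
matPow A zero    = identity
matPow A (suc k) = A ⊗ matPow A k

sign : ℕ → ℤ
sign zero    = + 1
sign (suc n) = - sign n

det : ∀ {n} → Mat n n → ℤ
det {zero}  M = + 1
det {suc n} M = sumFin (λ j → sign (toℕ j) ℤ.* (M zero j ℤ.* det (λ i k → M (suc i) (punchIn j k))))

StrictIncr : ∀ {s d} → (Fin s → Fin d) → Set
StrictIncr f = ∀ i j → i < j → f i < f j

minorDet : ∀ {d s} → Mat d d → (Fin s → Fin d) → (Fin s → Fin d) → ℤ
minorDet M f g = det (λ i j → M (f i) (g j))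

-- "the N-rank of M is at most r": no s×s minor with s > r has determinant
-- not divisible by N  (N-rank = greatest s having such a minor)
NRankAtMost : ∀ {d} → ℕ → Mat d d → ℕ → Set
NRankAtMost {d} N M r = ∀ s → r ℕ.< s → (f g : Fin s → Fin d) →
  StrictIncr f → StrictIncr g → N ℕD.∣ ∣ minorDet M f g ∣

RankAtMost : ∀ {d} → Mat d d → ℕ → Set
RankAtMost {d} M r = ∀ s → r ℕ.< s → (f g : Fin s → Fin d) →
  StrictIncr f → StrictIncr g → minorDet M f g ≡ + 0

IsOrd : ∀ {d} → Mat d d → ℕ → ℕ → ℕ → Set
IsOrd A N r k = (1 ℕ.≤ k) × NRankAtMost N (matPow A k ⊖ identity) r ×
  (∀ k' → 1 ℕ.≤ k' → k' ℕ.< k → ¬ NRankAtMost N (matPow A k' ⊖ identity) r)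

IsGcdMinors : ∀ {d} → Mat d d → ℕ → ℕ → Set
IsGcdMinors {d} M s g =
  (∀ (f h : Fin s → Fin d) → StrictIncr f → StrictIncr h → g ℕD.∣ ∣ minorDet M f h ∣) ×
  (∀ c → (∀ (f h : Fin s → Fin d) → StrictIncr f → StrictIncr h → c ℕD.∣ ∣ minorDet M f h ∣) → c ℕD.∣ g)

-- lim_{N→∞} ord(A,N,r)/log N = +∞  (ord = ∞ counts as large), written as:
-- for every M ≥ 1, for all sufficiently large N, N^M < 2^ord(A,N,r)
OrdOverLogToInfinity : ∀ {d} → Mat d d → ℕ → Set
OrdOverLogToInfinity A r = ∀ M → 1 ℕ.≤ M → Σ ℕ λ N₀ → ∀ N → N₀ ℕ.≤ N →
  ∀ k → IsOrd A N r k → N ℕ.^ M ℕ.< 2 ℕ.^ k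

-- for every ε > 0, eventually gcd_i x_{n,r+1,i} < exp(ε n), written as:
-- for every M ≥ 1, for all sufficiently large n, (gcd)^M < 2^n
GcdSubexponential : ∀ {d} → Mat d d → ℕ → Set
GcdSubexponential A r = ∀ M → 1 ℕ.≤ M → Σ ℕ λ n₀ → ∀ n → n₀ ℕ.≤ n →
  ∀ g → IsGcdMinors (matPow A n ⊖ identity) (suc r) g → g ℕ.^ M ℕ.< 2 ℕ.^ n

-- Let G_k be the gcd of the (r+1)-minors of A^k − I. By Laplace expansion an N dividing all
-- (r+1)-minors divides all larger ones, so N-rank(A^k − I) ≤ r iff N ∣ G_k, and G_k ≠ 0 for
-- k ≥ 1 because A has no finite global r-order; hence N ≤ G_k for k = ord(A,N,r).
-- If G_k is subexponential, either ord(A,N,r) lies below a fixed n₀, which bounds N by the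
-- G_k with k < n₀, or N^M ≤ G_k^M < 2^k. Conversely ord(A,G_n,r) ≤ n, so if ord(A,N,r) grows
-- faster than M log₂ N then G_n^M < 2^n for large n.
{-# OPTIONS --safe #-}
module Submission where

open import Defs
open import Data.Nat using (ℕ; _≤_; _+_; suc)
open import Data.Integer using (+_)
open import Data.Product using (Σ; _×_)
open import Function.Bundles using (_⇔_)
open import Relation.Nullary using (¬_)
open import Relation.Binary.PropositionalEquality using (_≢_)

open import Data.Nat using (zero; z≤n; s≤s; _<_; _*_; _^_; _⊔_; _<?_; NonZero; >-nonZero)
open import Data.Nat.Properties
open import Data.Nat.Divisibility using (_∣_; ∣-trans; ∣-refl; _∣0; 0∣⇒≡0; ∣⇒≤)
open import Data.Nat.GCD using (gcd; gcd[m,n]∣m; gcd[m,n]∣n; gcd-greatest)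
open import Data.Nat.Induction using (<-rec)
open import Data.Integer as ℤ using (ℤ; ∣_∣)
open import Data.Integer.Properties using (∣i∣≡0⇒i≡0)
open import Data.Integer.Divisibility.Signed as ℤ∣ using ()
open import Data.Fin as Fin using (Fin; punchIn; toℕ)
import Data.Fin.Properties as Fin
open import Data.Vec using (Vec; []; _∷_; lookup; tabulate)
open import Data.Vec.Properties using (lookup∘tabulate)
open import Data.Product using (_,_; proj₁; proj₂)
open import Data.Sum using (inj₁; inj₂)
open import Function using (_∘_)
open import Function.Bundles using (Equivalence; mk⇔)
open import Relation.Nullary using (Dec; yes; no; contradiction; _×-dec_; _→-dec_)
open import Relation.Nullary.Decidable using (decidable-stable)
open import Relation.Binary.PropositionalEquality
  using (_≡_; refl; sym; cong; cong₂; subst₂; module ≡-Reasoning)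

sumFin-cong : ∀ {n} {f g : Fin n → ℤ} → (∀ i → f i ≡ g i) → sumFin f ≡ sumFin g
sumFin-cong {zero}  f≗g = refl
sumFin-cong {suc n} f≗g = cong₂ ℤ._+_ (f≗g Fin.zero) (sumFin-cong (f≗g ∘ Fin.suc))

det-cong : ∀ {n} {P Q : Mat n n} → (∀ i j → P i j ≡ Q i j) → det P ≡ det Q
det-cong {zero}  P≗Q = refl
det-cong {suc n} P≗Q = sumFin-cong λ j →
  cong₂ (λ a b → sign (toℕ j) ℤ.* (a ℤ.* b)) (P≗Q Fin.zero j)
        (det-cong λ i k → P≗Q (Fin.suc i) (punchIn j k))

∣sumFin : ∀ {n} {c : ℤ} (t : Fin n → ℤ) → (∀ j → c ℤ∣.∣ t j) → c ℤ∣.∣ sumFin t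
∣sumFin {zero}  t c∣t = ℤ∣.∣ᵤ⇒∣ (_ ∣0)
∣sumFin {suc n} t c∣t = ℤ∣.∣m∣n⇒∣m+n (c∣t Fin.zero) (∣sumFin (t ∘ Fin.suc) (c∣t ∘ Fin.suc))

punchIn-mono-< : ∀ {n} (i : Fin (suc n)) (j k : Fin n) → j Fin.< k → punchIn i j Fin.< punchIn i k
punchIn-mono-< i j k j<k = Fin.≤∧≢⇒<
  (Fin.punchIn-mono-≤ i j k (<⇒≤ j<k))
  (Fin.<⇒≢ j<k ∘ Fin.punchIn-injective i j k)

StrictIncr-resp : ∀ {s d} {f g : Fin s → Fin d} → (∀ i → f i ≡ g i) → StrictIncr f → StrictIncr g
StrictIncr-resp f≗g f↑ i j i<j = subst₂ Fin._<_ (f≗g i) (f≗g j) (f↑ i j i<j)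

strictIncr? : ∀ {s d} (f : Fin s → Fin d) → Dec (StrictIncr f)
strictIncr? f = Fin.all? λ i → Fin.all? λ j → (i Fin.<? j) →-dec (f i Fin.<? f j)

DividesMinors : ∀ {d} → ℕ → Mat d d → ℕ → Set
DividesMinors {d} c X s = (f h : Fin s → Fin d) → StrictIncr f → StrictIncr h → c ∣ ∣ minorDet X f h ∣

DividesMinors-suc : ∀ {d c s} (X : Mat d d) → DividesMinors c X s → DividesMinors c X (suc s)
DividesMinors-suc {c = c} X c∣minors f h f↑ h↑ = ℤ∣.∣⇒∣ᵤ (∣sumFin _ λ j →
  ℤ∣.∣n⇒∣m*n (sign (toℕ j)) (ℤ∣.∣n⇒∣m*n (X (f Fin.zero) (h j)) (c∣subminor j)))
  where
  c∣subminor : ∀ j → + c ℤ∣.∣ minorDet X (f ∘ Fin.suc) (h ∘ punchIn j)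
  c∣subminor j = ℤ∣.∣ᵤ⇒∣ (c∣minors (f ∘ Fin.suc) (h ∘ punchIn j)
    (λ i i′ → f↑ (Fin.suc i) (Fin.suc i′) ∘ s≤s)
    (λ k k′ → h↑ (punchIn j k) (punchIn j k′) ∘ punchIn-mono-< j k k′))

DividesMinors⇒NRankAtMost : ∀ {d N r} (X : Mat d d) → DividesMinors N X (suc r) → NRankAtMost N X r
DividesMinors⇒NRankAtMost X N∣minors (suc s) (s≤s r≤s) with m≤n⇒m<n∨m≡n r≤s
... | inj₁ r<s  = DividesMinors-suc X (DividesMinors⇒NRankAtMost X N∣minors s r<s)
... | inj₂ refl = N∣minors

NRankAtMost⇔∣gcd : ∀ {d N r g} (X : Mat d d) → IsGcdMinors X (suc r) g → NRankAtMost N X r ⇔ N ∣ g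
NRankAtMost⇔∣gcd {N = N} {r = r} X (g∣minors , greatest) = mk⇔
  (λ rank≤r → greatest N (rank≤r (suc r) ≤-refl))
  (λ N∣g → DividesMinors⇒NRankAtMost X λ f h f↑ h↑ → ∣-trans N∣g (g∣minors f h f↑ h↑))

gcdMinors≡0⇒RankAtMost : ∀ {d r} (X : Mat d d) → IsGcdMinors X (suc r) 0 → RankAtMost X r
gcdMinors≡0⇒RankAtMost X isGcd s r<s f h f↑ h↑ =
  ∣i∣≡0⇒i≡0 (0∣⇒≡0 (Equivalence.from (NRankAtMost⇔∣gcd {N = 0} X isGcd) ∣-refl s r<s f h f↑ h↑))

IsGcdOf : ∀ {A : Set} → (A → ℕ) → ℕ → Set
IsGcdOf {A} φ g = (∀ x → g ∣ φ x) × (∀ c → (∀ x → c ∣ φ x) → c ∣ g)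

HasGcds : Set → Set
HasGcds A = (φ : A → ℕ) → Σ ℕ (IsGcdOf φ)

Fin-hasGcds : ∀ {n} → HasGcds (Fin n)
Fin-hasGcds {zero}  φ = 0 , (λ ()) , (λ c _ → c ∣0)
Fin-hasGcds {suc n} φ with Fin-hasGcds (φ ∘ Fin.suc)
... | g , g∣φ , greatest = gcd (φ Fin.zero) g
  , (λ { Fin.zero → gcd[m,n]∣m _ _ ; (Fin.suc i) → ∣-trans (gcd[m,n]∣n (φ Fin.zero) g) (g∣φ i) })
  , λ c c∣φ → gcd-greatest (c∣φ Fin.zero) (greatest c (c∣φ ∘ Fin.suc))

×-hasGcds : ∀ {A B} → HasGcds A → HasGcds B → HasGcds (A × B)
×-hasGcds gcdsA gcdsB φ = proj₁ outer , G∣φ , greatest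
  where
  inner : ∀ a → Σ ℕ (IsGcdOf (λ b → φ (a , b)))
  inner a = gcdsB λ b → φ (a , b)
  outer : Σ ℕ (IsGcdOf (proj₁ ∘ inner))
  outer = gcdsA (proj₁ ∘ inner)
  G∣φ : ∀ ab → proj₁ outer ∣ φ ab
  G∣φ (a , b) = ∣-trans (proj₁ (proj₂ outer) a) (proj₁ (proj₂ (inner a)) b)
  greatest : ∀ c → (∀ ab → c ∣ φ ab) → c ∣ proj₁ outer
  greatest c c∣φ = proj₂ (proj₂ outer) c λ a → proj₂ (proj₂ (inner a)) c λ b → c∣φ (a , b)

Vec-hasGcds : ∀ {A} → HasGcds A → ∀ n → HasGcds (Vec A n)
Vec-hasGcds gcdsA zero    φ = φ [] , (λ { [] → ∣-refl }) , (λ c c∣φ → c∣φ [])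
Vec-hasGcds gcdsA (suc n) φ with ×-hasGcds gcdsA (Vec-hasGcds gcdsA n) (λ (x , xs) → φ (x ∷ xs))
... | g , g∣φ , greatest = g , (λ { (x ∷ xs) → g∣φ (x , xs) }) , λ c c∣φ → greatest c λ (x , xs) → c∣φ (x ∷ xs)

when : ∀ {P : Set} → Dec P → ℕ → ℕ
when (yes _) n = n
when (no _)  _ = 0

when-yes : ∀ {P : Set} (p? : Dec P) {n} → P → when p? n ≡ n
when-yes (yes _) p = refl
when-yes (no ¬p) p = contradiction p ¬p

∣when : ∀ {P : Set} (p? : Dec P) {c n} → (P → c ∣ n) → c ∣ when p? n
∣when (yes p) c∣n = c∣n p
∣when (no _)  _   = _ ∣0

gcdMinors : ∀ {d} (X : Mat d d) s → Σ ℕ (IsGcdMinors X s)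
gcdMinors {d} X s = g , g∣minors , greatest
  where
  -- Index selections are enumerated as vectors; non-increasing ones contribute 0 to the gcd.
  strictMinor : Vec (Fin d) s × Vec (Fin d) s → ℕ
  strictMinor (u , v) =
    when (strictIncr? (lookup u) ×-dec strictIncr? (lookup v)) ∣ minorDet X (lookup u) (lookup v) ∣
  VecFin-hasGcds : HasGcds (Vec (Fin d) s)
  VecFin-hasGcds = Vec-hasGcds Fin-hasGcds s
  g : ℕ
  g = proj₁ (×-hasGcds VecFin-hasGcds VecFin-hasGcds strictMinor)
  isGcd : IsGcdOf strictMinor g
  isGcd = proj₂ (×-hasGcds VecFin-hasGcds VecFin-hasGcds strictMinor)
  strictMinor-tabulate : ∀ f h → StrictIncr f → StrictIncr h →
                         strictMinor (tabulate f , tabulate h) ≡ ∣ minorDet X f h ∣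
  strictMinor-tabulate f h f↑ h↑ = begin
    strictMinor (tabulate f , tabulate h)
      ≡⟨ when-yes (strictIncr? _ ×-dec strictIncr? _)
           (StrictIncr-resp (sym ∘ lookup∘tabulate f) f↑ , StrictIncr-resp (sym ∘ lookup∘tabulate h) h↑) ⟩
    ∣ minorDet X (lookup (tabulate f)) (lookup (tabulate h)) ∣
      ≡⟨ cong ∣_∣ (det-cong λ i j → cong₂ X (lookup∘tabulate f i) (lookup∘tabulate h j)) ⟩
    ∣ minorDet X f h ∣ ∎
    where open ≡-Reasoning
  g∣minors : DividesMinors g X s
  g∣minors f h f↑ h↑ =
    subst₂ _∣_ refl (strictMinor-tabulate f h f↑ h↑) (proj₁ isGcd (tabulate f , tabulate h))
  greatest : ∀ c → DividesMinors c X s → c ∣ g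
  greatest c c∣minors = proj₂ isGcd c λ (u , v) →
    ∣when (strictIncr? _ ×-dec strictIncr? _) λ (u↑ , v↑) → c∣minors (lookup u) (lookup v) u↑ v↑

n<2^n : ∀ n → n < 2 ^ n
n<2^n zero    = s≤s z≤n
n<2^n (suc n) = begin-strict
  suc n     ≤⟨ n<2^n n ⟩
  2 ^ n     <⟨ m<m*n (2 ^ n) 2 {{m^n≢0 2 n}} ≤-refl ⟩
  2 ^ n * 2 ≡⟨ *-comm (2 ^ n) 2 ⟩
  2 ^ suc n ∎
  where open ≤-Reasoning

^<2^ : ∀ M .{{_ : NonZero M}} {m n} → m * M ≤ n → m ^ M < 2 ^ n
^<2^ M {m} {n} mM≤n = begin-strict
  m ^ M       <⟨ ^-monoˡ-< M (n<2^n m) ⟩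
  (2 ^ m) ^ M ≡⟨ ^-*-assoc 2 m M ⟩
  2 ^ (m * M) ≤⟨ ^-monoʳ-≤ 2 mM≤n ⟩
  2 ^ n       ∎
  where open ≤-Reasoning

strictBoundBelow : (ℕ → ℕ) → ℕ → ℕ
strictBoundBelow f zero    = 0
strictBoundBelow f (suc n) = suc (f n) ⊔ strictBoundBelow f n

<strictBoundBelow : ∀ f {k n} → k < n → f k < strictBoundBelow f n
<strictBoundBelow f {k} {suc n} k<1+n with m<1+n⇒m<n∨m≡n k<1+n
... | inj₁ k<n  = m<n⇒m<o⊔n (suc (f n)) (<strictBoundBelow f k<n)
... | inj₂ refl = m<n⇒m<n⊔o (strictBoundBelow f n) ≤-refl

¬¬-least-≤ : ∀ {P : ℕ → Set} {n} → P n → ¬ ¬ (Σ ℕ λ k → k ≤ n × P k × (∀ j → j < k → ¬ P j))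
¬¬-least-≤ {P} {n} = <-rec Goal step n
  where
  Goal : ℕ → Set
  Goal n = P n → ¬ ¬ (Σ ℕ λ k → k ≤ n × P k × (∀ j → j < k → ¬ P j))
  step : ∀ n → (∀ {j} → j < n → Goal j) → Goal n
  step n rec pn ¬least = ¬least (n , ≤-refl , pn , λ j j<n pj →
    rec j<n pj λ (k , k≤j , rest) → ¬least (k , ≤-trans k≤j (<⇒≤ j<n) , rest))

module _ {d} (A : Mat d d) (r : ℕ) where

  private
    B : ℕ → Mat d d
    B k = matPow A k ⊖ identity

  NoGlobalOrder : Set
  NoGlobalOrder = ∀ k → 1 ≤ k → ¬ RankAtMost (B k) r

  ¬¬ord≤ : ∀ {N n} → 1 ≤ n → NRankAtMost N (B n) r → ¬ ¬ (Σ ℕ λ k → k ≤ n × IsOrd A N r k)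
  ¬¬ord≤ {N} 1≤n rank≤r ¬ord =
    ¬¬-least-≤ {P = λ k → 1 ≤ k × NRankAtMost N (B k) r} (1≤n , rank≤r)
      λ (k , k≤n , (1≤k , rankₖ≤r) , minimal) →
        ¬ord (k , k≤n , 1≤k , rankₖ≤r , λ j 1≤j j<k rankⱼ≤r → minimal j j<k (1≤j , rankⱼ≤r))

  IsOrd⇒≤gcdMinors : NoGlobalOrder → ∀ {N k g} → IsOrd A N r k → IsGcdMinors (B k) (suc r) g → N ≤ g
  IsOrd⇒≤gcdMinors noGlobal {k = k} {g = zero}  (1≤k , _ , _) isGcd =
    contradiction (gcdMinors≡0⇒RankAtMost (B k) isGcd) (noGlobal k 1≤k)
  IsOrd⇒≤gcdMinors noGlobal {k = k} {g = suc _} (_ , rank≤r , _) isGcd =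
    ∣⇒≤ (Equivalence.to (NRankAtMost⇔∣gcd (B k) isGcd) rank≤r)

  GcdSubexponential⇒OrdOverLogToInfinity : NoGlobalOrder → GcdSubexponential A r → OrdOverLogToInfinity A r
  GcdSubexponential⇒OrdOverLogToInfinity noGlobal gcdSmall M 1≤M = strictBoundBelow G n₀ , ordLarge
    where
    n₀ : ℕ
    n₀ = proj₁ (gcdSmall M 1≤M)
    G : ℕ → ℕ
    G k = proj₁ (gcdMinors (B k) (suc r))
    G-isGcd : ∀ k → IsGcdMinors (B k) (suc r) (G k)
    G-isGcd k = proj₂ (gcdMinors (B k) (suc r))
    ordLarge : ∀ N → strictBoundBelow G n₀ ≤ N → ∀ k → IsOrd A N r k → N ^ M < 2 ^ k
    ordLarge N G<N k isOrd with N≤Gₖ ← IsOrd⇒≤gcdMinors noGlobal isOrd (G-isGcd k) | k <? n₀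
    ... | yes k<n₀ = contradiction N≤Gₖ (<⇒≱ (<-≤-trans (<strictBoundBelow G k<n₀) G<N))
    ... | no  k≮n₀ = ≤-<-trans (^-monoˡ-≤ M N≤Gₖ) (proj₂ (gcdSmall M 1≤M) k (≮⇒≥ k≮n₀) (G k) (G-isGcd k))

  OrdOverLogToInfinity⇒GcdSubexponential : OrdOverLogToInfinity A r → GcdSubexponential A r
  OrdOverLogToInfinity⇒GcdSubexponential ordLarge M 1≤M = suc (N₀ * M) , gcdSmall
    where
    instance
      _ : NonZero M
      _ = >-nonZero 1≤M
    N₀ : ℕ
    N₀ = proj₁ (ordLarge M 1≤M)
    gcdSmall : ∀ n → suc (N₀ * M) ≤ n → ∀ g → IsGcdMinors (B n) (suc r) g → g ^ M < 2 ^ n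
    gcdSmall n N₀M<n g isGcd with g <? N₀
    ... | yes g<N₀ = ^<2^ M (≤-trans (*-monoˡ-≤ M (<⇒≤ g<N₀)) (<⇒≤ N₀M<n))
    -- ¬¬-least-≤ yields ord(A,g,r) ≤ n only up to ¬¬, which suffices as the goal is decidable.
    ... | no  g≮N₀ = decidable-stable (g ^ M <? 2 ^ n) λ g^M≮2^n →
      ¬¬ord≤ (≤-trans (s≤s z≤n) N₀M<n) (Equivalence.from (NRankAtMost⇔∣gcd (B n) isGcd) ∣-refl)
        λ (k , k≤n , isOrd) →
          g^M≮2^n (<-≤-trans (proj₂ (ordLarge M 1≤M) g (≮⇒≥ g≮N₀) k isOrd) (^-monoʳ-≤ 2 k≤n))

lemma1 : (d : ℕ) → 2 ≤ d → (A : Mat d d) → det A ≢ + 0 →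
    (r : ℕ) → r + 2 ≤ d →
    ¬ (Σ ℕ λ k → (1 ≤ k) × RankAtMost (matPow A k ⊖ identity) r) →
    OrdOverLogToInfinity A r ⇔ GcdSubexponential A r
lemma1 d _ A _ r _ noGlobalOrder = mk⇔
  (OrdOverLogToInfinity⇒GcdSubexponential A r)
  (GcdSubexponential⇒OrdOverLogToInfinity A r λ k 1≤k rank≤r → noGlobalOrder (k , 1≤k , rank≤r))
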